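{- This action can not be extended to the letter-wise action of $S_4$.
   Context: Let $\mathcal{B}=\{\mathtt{A},\mathtt{C},\mathtt{G},\mathtt{T}\}$ be the genetic alphabet, and let $c\colon\mathcal{B}\to\mathcal{B}$ be the complementarity map $c(\mathtt{A})=\mathtt{T}$, $c(\mathtt{T})=\mathtt{A}$, $c(\mathtt{C})=\mathtt{G}$, $c(\mathtt{G})=\mathtt{C}$. For a codon $w=N_1N_2N_3\in\mathcal{B}^3$ its reverse complement is $\overleftarrow{c}(w)=c(N_3)c(N_2)c(N_1)$, and $\alpha(N_1N_2N_3)=N_3N_1N_2$ is the cyclic shift. A set of 3-letter words is a circular code if any concatenation of its words written on a circle can be decomposed into a concatenation of its words in a unique way. "Circular code" means a maximal $C^3$ circular code: a circular code $\mathcal{C}$ with $|\mathcal{C}|=20$, $\overleftarrow{c}(\mathcal{C})=\mathcal{C}$, and $\alpha(\mathcal{C})$ (hence also $\alpha^2(\mathcal{C})$) circular. The action in question is the action on circular codes of the dihedral group $D_4$, induced letter-wise from its action by symmetries of a square whose vertices are labeled by the bases with $\mathtt{A},\mathtt{T}$ opposite and $\mathtt{C},\mathtt{G}$ opposite: the central reflection is $c$, the two axis reflections are the purine-pyrimidine duality $p$ ($\mathtt{A}\leftrightarrow\mathtt{G}$, $\mathtt{C}\leftrightarrow\mathtt{T}$) and the keto-amine duality $r$ ($\mathtt{A}\leftrightarrow\mathtt{C}$, $\mathtt{G}\leftrightarrow\mathtt{T}$). The claim is that this $D_4$-action does not extend to an action of the full symmetric group $S_4$ acting letter-wise on $\mathcal{B}$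 (preserving the set of circular codes). -}

module Defs where

open import Data.Bool using (Bool; true; false) renaming (T to IsTrue)
open import Data.List using (List; []; _∷_; _++_; concatMap; filter; length)
open import Data.List.Relation.Unary.All using (All)
open import Data.Nat using (ℕ)
open import Data.Product using (_×_; _,_)
open import Function.Bundles using (_↔_; Inverse)
open import Relation.Binary.PropositionalEquality using (_≡_)
open import Relation.Nullary using (¬_)

data Base : Set where
  A C G T : Base

comp : Base → Base
comp A = T
comp T = A
comp C = G
comp G = C

Codon : Set
Codon = Base × Base × Base

word : Codon → List Base
word (a , b , c) = a ∷ b ∷ c ∷ []

revComp : Codon → Codon
revComp (a , b , c) = (comp c , comp b , comp a)

α : Codon → Codon
α (a , b , c) = (c , a , b)

α⁻¹ : Codon → Codon
α⁻¹ (a , b , c) = (b , c , a)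

Code : Set
Code = Codon → Bool

_∈ᶜ_ : Codon → Code → Set
w ∈ᶜ X = IsTrue (X w)

allBases : List Base
allBases = A ∷ C ∷ G ∷ T ∷ []

allCodons : List Codon
allCodons = concatMap (λ a → concatMap (λ b → Data.List.map (λ c → (a , b , c)) allBases) allBases) allBases

size : Code → ℕ
size X = length (filter (λ w → Data.Bool._≟_ (X w) true) allCodons)

flat : List Codon → List Base
flat = concatMap word

-- Circular code (standard definition, e.g. Michel et al.):
-- for all x₁…xₙ, y₁…yₘ ∈ X (n, m ≥ 1), p ∈ B*, s ∈ B⁺,
-- if  s x₂…xₙ p = y₁…yₘ  and  x₁ = p s, then n = m, p = ε and xᵢ = yᵢ.
-- (This expresses that every word written on a circle has at most one
-- decomposition into words of X.)
IsCircular : Code → Set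
IsCircular X =
  ∀ (x : Codon) (xs ys : List Codon) (p s : List Base) →
  x ∈ᶜ X → All (_∈ᶜ X) xs → All (_∈ᶜ X) ys →
  ¬ (s ≡ []) →
  word x ≡ p ++ s →
  s ++ flat xs ++ p ≡ flat ys →
  (p ≡ []) × (x ∷ xs ≡ ys)

-- image of a code under a bijection f of codons, given by its inverse g
-- (w ∈ f(X) iff g w ∈ X)
imageBy : (Codon → Codon) → Code → Code
imageBy g X w = X (g w)

αImage : Code → Code
αImage = imageBy α⁻¹

IsMaxC3 : Code → Set
IsMaxC3 X =
  IsCircular X × size X ≡ 20 ×
  (∀ w → X (revComp w) ≡ X w) ×
  IsCircular (αImage X) × IsCircular (αImage (αImage X))

codonMap : (Base → Base) → Codon → Codon
codonMap f (a , b , c) = (f a , f b , f c)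

act : Base ↔ Base → Code → Code
act σ X = imageBy (codonMap (Inverse.from σ)) X

-- A maximal C³ self-complementary circular code is not stable under every letter
-- permutation: the transposition A ↔ C does not commute with complementarity, so it maps
-- the Arquès–Michel code X₀ to a code containing CCA but not its reverse complement TGG.
-- That X₀ is a maximal C³ code is checked by computation, circularity via the graph
-- criterion: a code X is circular as soon as the vertices N and N₁N₂ of its graph
-- (edges N₁ → N₂N₃ and N₁N₂ → N₃ for N₁N₂N₃ ∈ X) admit a strictly increasing grading,
-- since a second decomposition of a circular word would yield a closed path.
module Submission where

open import Defs
open import Data.Bool using (true; false) renaming (_≟_ to _≟ᵇ_)
open import Data.List using (List; []; _∷_; _++_)
open import Data.List.Properties using (∷-injective; ++-identityʳ)
open import Data.List.Relation.Unary.All using (All; []; _∷_)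
open import Data.Nat using (ℕ; _<_)
open import Data.Nat.Properties using (_<?_; <-trans; <-asym)
open import Data.Product using (Σ-syntax; _×_; _,_; proj₁; proj₂)
open import Function.Bundles using (_↔_; mk↔ₛ′)
open import Relation.Binary.PropositionalEquality using (_≡_; refl; cong; trans; sym)
open import Relation.Nullary using (¬_; Dec; contradiction)
open import Relation.Nullary.Decidable using (map′; _×-dec_; _→-dec_; T?; from-yes)
open import Relation.Unary using (Decidable)

∀-Base? : {P : Base → Set} → Decidable P → Dec (∀ x → P x)
∀-Base? P? =
  map′ (λ { (pA , pC , pG , pT) → λ { A → pA ; C → pC ; G → pG ; T → pT } })
       (λ h → h A , h C , h G , h T)
       (P? A ×-dec P? C ×-dec P? G ×-dec P? T)

∀-Codon? : {P : Codon → Set} → Decidable P → Dec (∀ w → P w)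
∀-Codon? P? =
  map′ (λ h → λ { (a , b , c) → h a b c })
       (λ h a b c → h (a , b , c))
       (∀-Base? λ a → ∀-Base? λ b → ∀-Base? λ c → P? (a , b , c))

flat-injective : ∀ xs ys → flat xs ≡ flat ys → xs ≡ ys
flat-injective [] [] eq = refl
flat-injective ((a , b , c) ∷ xs) ((d , e , f) ∷ ys) eq
  with refl , eq₁ ← ∷-injective eq
  with refl , eq₂ ← ∷-injective eq₁
  with refl , eq₃ ← ∷-injective eq₂
  = cong ((a , b , c) ∷_) (flat-injective xs ys eq₃)

flat-uncons : ∀ (X : Code) a b c rest ys → a ∷ b ∷ c ∷ rest ≡ flat ys → All (_∈ᶜ X) ys →
              ((a , b , c) ∈ᶜ X) × (Σ[ ys′ ∈ List Codon ] All (_∈ᶜ X) ys′ × rest ≡ flat ys′)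
flat-uncons X a b c rest (_ ∷ ys′) refl (abc∈X ∷ ys′⊆X) = abc∈X , ys′ , ys′⊆X , refl

IncreasingAt : Code → (Base → ℕ) → (Base → Base → ℕ) → Codon → Set
IncreasingAt X ρ₁ ρ₂ (a , b , c) = (a , b , c) ∈ᶜ X → ρ₁ a < ρ₂ b c × ρ₂ a b < ρ₁ c

increasingAt? : ∀ X ρ₁ ρ₂ → Decidable (IncreasingAt X ρ₁ ρ₂)
increasingAt? X ρ₁ ρ₂ (a , b , c) = T? (X (a , b , c)) →-dec (ρ₁ a <? ρ₂ b c ×-dec ρ₂ a b <? ρ₁ c)

record Grading (X : Code) : Set where
  field
    ρ₁ : Base → ℕ
    ρ₂ : Base → Base → ℕ
    increasing : ∀ w → IncreasingAt X ρ₁ ρ₂ w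

module _ {X : Code} (grading : Grading X) where
  open Grading grading

  ρ₂<ρ₁-along : ∀ d₁ d₂ a xs ys → All (_∈ᶜ X) xs → All (_∈ᶜ X) ys →
                d₁ ∷ d₂ ∷ flat xs ++ a ∷ [] ≡ flat ys → ρ₂ d₁ d₂ < ρ₁ a
  ρ₂<ρ₁-along d₁ d₂ a [] ys _ ys⊆X eq =
    increasing (d₁ , d₂ , a) (proj₁ (flat-uncons X d₁ d₂ a [] ys eq ys⊆X)) .proj₂
  ρ₂<ρ₁-along d₁ d₂ a ((z , u , v) ∷ xs) ys (zuv∈X ∷ xs⊆X) ys⊆X eq
    with d₁d₂z∈X , ys′ , ys′⊆X , eq′ ← flat-uncons X d₁ d₂ z _ ys eq ys⊆X =
    <-trans (increasing (d₁ , d₂ , z) d₁d₂z∈X .proj₂)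
      (<-trans (increasing (z , u , v) zuv∈X .proj₁) (ρ₂<ρ₁-along u v a xs ys′ xs⊆X ys′⊆X eq′))

  ρ₁<ρ₂-along : ∀ d a b xs ys → All (_∈ᶜ X) xs → All (_∈ᶜ X) ys →
                d ∷ flat xs ++ a ∷ b ∷ [] ≡ flat ys → ρ₁ d < ρ₂ a b
  ρ₁<ρ₂-along d a b [] ys _ ys⊆X eq =
    increasing (d , a , b) (proj₁ (flat-uncons X d a b [] ys eq ys⊆X)) .proj₁
  ρ₁<ρ₂-along d a b ((z , u , v) ∷ xs) ys (zuv∈X ∷ xs⊆X) ys⊆X eq
    with dzu∈X , ys′ , ys′⊆X , eq′ ← flat-uncons X d z u _ ys eq ys⊆X =
    <-trans (increasing (d , z , u) dzu∈X .proj₁)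
      (<-trans (increasing (z , u , v) zuv∈X .proj₂) (ρ₁<ρ₂-along v a b xs ys′ xs⊆X ys′⊆X eq′))

  graded⇒circular : IsCircular X
  graded⇒circular (a , b , c) xs ys [] _ _ _ _ _ refl eq =
    refl , flat-injective ((a , b , c) ∷ xs) ys
             (trans (cong (λ l → a ∷ b ∷ c ∷ l) (sym (++-identityʳ (flat xs)))) eq)
  graded⇒circular (a , b , c) xs ys (_ ∷ []) _ abc∈X xs⊆X ys⊆X _ refl eq =
    contradiction (ρ₂<ρ₁-along b c a xs ys xs⊆X ys⊆X eq)
                  (<-asym (increasing (a , b , c) abc∈X .proj₁))
  graded⇒circular (a , b , c) xs ys (_ ∷ _ ∷ []) _ abc∈X xs⊆X ys⊆X _ refl eq =
    contradiction (ρ₁<ρ₂-along c a b xs ys xs⊆X ys⊆X eq)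
                  (<-asym (increasing (a , b , c) abc∈X .proj₂))
  graded⇒circular _ _ _ (_ ∷ _ ∷ _ ∷ []) _ _ _ _ s≢[] refl _ = contradiction refl s≢[]

-- The code of Arquès and Michel (1996), identified in the reading frame of genes.
X₀ : Code
X₀ (A , A , C) = true
X₀ (A , A , T) = true
X₀ (A , C , C) = true
X₀ (A , T , C) = true
X₀ (A , T , T) = true
X₀ (C , A , G) = true
X₀ (C , T , C) = true
X₀ (C , T , G) = true
X₀ (G , A , A) = true
X₀ (G , A , C) = true
X₀ (G , A , G) = true
X₀ (G , A , T) = true
X₀ (G , C , C) = true
X₀ (G , G , C) = true
X₀ (G , G , T) = true
X₀ (G , T , A) = true
X₀ (G , T , C) = true
X₀ (G , T , T) = true
X₀ (T , A , C) = true
X₀ (T , T , C) = true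
X₀ _ = false

SelfComplementary : Code → Set
SelfComplementary X = ∀ w → X (revComp w) ≡ X w

X₀-selfComplementary : SelfComplementary X₀
X₀-selfComplementary = from-yes (∀-Codon? λ w → X₀ (revComp w) ≟ᵇ X₀ w)

X₀-graded : Grading X₀
X₀-graded = record
  { ρ₁ = ρ₁ ; ρ₂ = ρ₂ ; increasing = from-yes (∀-Codon? (increasingAt? X₀ ρ₁ ρ₂)) }
  where
  ρ₁ : Base → ℕ
  ρ₁ A = 3
  ρ₁ C = 7
  ρ₁ G = 1
  ρ₁ T = 5

  ρ₂ : Base → Base → ℕ
  ρ₂ A A = 2
  ρ₂ A C = 6
  ρ₂ A G = 8
  ρ₂ A T = 4
  ρ₂ C C = 4
  ρ₂ G C = 2
  ρ₂ G T = 2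
  ρ₂ T A = 2
  ρ₂ T C = 8
  ρ₂ T G = 8
  ρ₂ T T = 4
  ρ₂ _ _ = 0

αX₀-graded : Grading (αImage X₀)
αX₀-graded = record
  { ρ₁ = ρ₁ ; ρ₂ = ρ₂ ; increasing = from-yes (∀-Codon? (increasingAt? (αImage X₀) ρ₁ ρ₂)) }
  where
  ρ₁ : Base → ℕ
  ρ₁ A = 7
  ρ₁ C = 3
  ρ₁ G = 1
  ρ₁ T = 5

  ρ₂ : Base → Base → ℕ
  ρ₂ A A = 6
  ρ₂ A C = 4
  ρ₂ A T = 6
  ρ₂ C A = 2
  ρ₂ C T = 4
  ρ₂ G A = 8
  ρ₂ G C = 4
  ρ₂ G G = 6
  ρ₂ G T = 8
  ρ₂ T A = 4
  ρ₂ T T = 4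
  ρ₂ _ _ = 0

α²X₀-graded : Grading (αImage (αImage X₀))
α²X₀-graded = record
  { ρ₁ = ρ₁ ; ρ₂ = ρ₂ ; increasing = from-yes (∀-Codon? (increasingAt? (αImage (αImage X₀)) ρ₁ ρ₂)) }
  where
  ρ₁ : Base → ℕ
  ρ₁ A = 3
  ρ₁ C = 7
  ρ₁ G = 5
  ρ₁ T = 1

  ρ₂ : Base → Base → ℕ
  ρ₂ A G = 4
  ρ₂ C A = 8
  ρ₂ C C = 2
  ρ₂ C G = 8
  ρ₂ C T = 4
  ρ₂ G C = 4
  ρ₂ G G = 4
  ρ₂ T A = 4
  ρ₂ T G = 6
  ρ₂ _ _ = 0

X₀-maxC3 : IsMaxC3 X₀
X₀-maxC3 = graded⇒circular X₀-graded , refl , X₀-selfComplementary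
         , graded⇒circular αX₀-graded , graded⇒circular α²X₀-graded

swapAC : Base ↔ Base
swapAC = mk↔ₛ′ swap swap involutive involutive
  where
  swap : Base → Base
  swap A = C
  swap C = A
  swap G = G
  swap T = T

  involutive : ∀ x → swap (swap x) ≡ x
  involutive A = refl
  involutive C = refl
  involutive G = refl
  involutive T = refl

-- swapAC X₀ contains CCA (the image of AAC) but not TGG = revComp CCA.
swapAC-X₀-not-selfComplementary : ¬ SelfComplementary (act swapAC X₀)
swapAC-X₀-not-selfComplementary selfComp = contradiction (selfComp (C , C , A)) λ ()

mainTheorem6 : ¬ (∀ (σ : Base ↔ Base) (X : Code) → IsMaxC3 X → IsMaxC3 (act σ X))
mainTheorem6 preserved =
  swapAC-X₀-not-selfComplementary (proj₁ (proj₂ (proj₂ (preserved swapAC X₀ X₀-maxC3))))
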